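{- $\mathsf{ECT}\times \mathsf{WOP}(X\mapsto X^\omega) \le_{\mathrm W} \mathsf{ORT}_{\mathbb N}$.
   Context: A problem is a partial multi-valued function from instances to sets of solutions. $\mathsf P\le_{\mathrm W}\mathsf Q$ means there are Turing functionals $H,K$ such that for every $\mathsf P$-instance $X$, $H(X)$ is a $\mathsf Q$-instance, and for every $\mathsf Q$-solution $\hat Y$ to $H(X)$, $K(X\oplus\hat Y)$ is a $\mathsf P$-solution to $X$. The parallel product $\mathsf P\times\mathsf Q$ has instances pairs $(X_0,X_1)$ of a $\mathsf P$-instance and a $\mathsf Q$-instance, and solutions pairs of respective solutions. $\mathsf{ORT}_{\mathbb N}$: a colouring $c:[\mathbb N]^2\to P$ into a poset is right-ordered if $c(x,y)\le_P c(x,y')$ whenever $x<y\le y'$; instances are finite posets with a right-ordered colouring, solutions are infinite $c$-homogeneous subsets of $\mathbb N$. $\mathsf{ECT}$: instances are pairs $(n,f)$ with $f:\mathbb N\to\{0,\dots,n-1\}$; $b$ is a solution iff for every $x>b$ there is $y>x$ with $f(x)=f(y)$. For a linear order $(X,\le_X)$ (with $0$ its least element), $X^\omega$ is the set of finite sequences $\langle (b_0,a_0),\dots,(b_n,a_n)\rangle$ with $b_i\in\mathbb N$, $b_0>\dots>b_n$, $a_i\in X\setminus\{0\}$, ordered lexicographically: proper extensions are larger; otherwise at the first differing position $j$, $\sigma>\tau$ iff $b_j>b'_j$, or $b_j=b'_j$ and $a_j>_Xa'_j$. A sequence $\sigma'$ in $X$ is contained in a sequence $\sigma$ in $X^\omega$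 if each $\sigma'_i$ is an entry $a_k$ of some term $\sigma_{t_i}$ with $t_i\le t_j$ for $i<j$. $\mathsf{WOP}(X\mapsto X^\omega)$: instance is a linear order $X$ with an infinite decreasing sequence $\sigma$ in $X^\omega$; solutions are infinite decreasing sequences in $X$ contained in $\sigma$. -}

module Defs where

open import Data.Nat using (ℕ; zero; suc; _+_; _<_; _≤_)
open import Data.Fin using (Fin)
open import Data.Vec using (Vec; []; _∷_; lookup)
open import Data.List using (List; []; _∷_; map; upTo)
open import Data.List.Relation.Unary.Any using (Any)
open import Data.Product using (Σ; _×_; _,_; proj₂)
open import Data.Sum using (_⊎_)
open import Relation.Binary.PropositionalEquality using (_≡_; _≢_)

data Code : ℕ → Set where
  zer  : ∀ {n} → Code n
  sucC : Code 1
  proj : ∀ {n} → Fin n → Code n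
  orc  : Code 1
  comp : ∀ {m n} → Code m → Vec (Code n) m → Code n
  prec : ∀ {n} → Code n → Code (suc (suc n)) → Code (suc n)
  mu   : ∀ {n} → Code (suc n) → Code n

mutual
  data Eval (f : ℕ → ℕ) : ∀ {n} → Code n → Vec ℕ n → ℕ → Set where
    ezer  : ∀ {n} {xs : Vec ℕ n} → Eval f zer xs 0
    esuc  : ∀ {x} → Eval f sucC (x ∷ []) (suc x)
    eproj : ∀ {n} {i : Fin n} {xs} → Eval f (proj i) xs (lookup xs i)
    eorc  : ∀ {x} → Eval f orc (x ∷ []) (f x)
    ecomp : ∀ {m n} {h : Code m} {gs : Vec (Code n) m} {xs ys z} →
            EvalVec f gs xs ys → Eval f h ys z → Eval f (comp h gs) xs z
    eprec0 : ∀ {n} {g : Code n} {h} {xs z} →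
             Eval f g xs z → Eval f (prec g h) (0 ∷ xs) z
    eprecS : ∀ {n} {g : Code n} {h} {k xs z w} →
             Eval f (prec g h) (k ∷ xs) z → Eval f h (k ∷ z ∷ xs) w →
             Eval f (prec g h) (suc k ∷ xs) w
    emu   : ∀ {n} {g : Code (suc n)} {xs y} →
            Eval f g (y ∷ xs) 0 →
            (∀ i → i < y → Σ ℕ λ v → Eval f g (i ∷ xs) (suc v)) →
            Eval f (mu g) xs y

  data EvalVec (f : ℕ → ℕ) {n : ℕ} : ∀ {m} → Vec (Code n) m → Vec ℕ n → Vec ℕ m → Set where
    evnil  : ∀ {xs} → EvalVec f [] xs []
    evcons : ∀ {m} {g : Code n} {gs : Vec (Code n) m} {xs y ys} →
             Eval f g xs y → EvalVec f gs xs ys → EvalVec f (g ∷ gs) xs (y ∷ ys)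

Functional : Set
Functional = Code 1

Computes : Functional → (ℕ → ℕ) → (ℕ → ℕ) → Set
Computes e X Y = ∀ n → Eval X e (n ∷ []) (Y n)

triangle : ℕ → ℕ
triangle zero    = zero
triangle (suc k) = suc k + triangle k

pair : ℕ → ℕ → ℕ
pair x y = triangle (x + y) + y

cmp : ℕ → (ℕ → ℕ) → (ℕ → ℕ)
cmp i X m = X (pair i m)

-- Turing join: (X ⊕ Y)(2n) = X n, (X ⊕ Y)(2n+1) = Y n
_⊕_ : (ℕ → ℕ) → (ℕ → ℕ) → (ℕ → ℕ)
(X ⊕ Y) zero = X zero
(X ⊕ Y) (suc zero) = Y zero
(X ⊕ Y) (suc (suc n)) = ((λ m → X (suc m)) ⊕ (λ m → Y (suc m))) n

record Problem : Set₁ where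
  field
    Inst : (ℕ → ℕ) → Set
    Sol  : (ℕ → ℕ) → (ℕ → ℕ) → Set
open Problem public

_≤W_ : Problem → Problem → Set
P ≤W Q = Σ Functional λ H → Σ Functional λ K →
  ∀ X → Inst P X →
    Σ (ℕ → ℕ) λ HX → Computes H X HX × Inst Q HX ×
      (∀ Ŷ → Sol Q HX Ŷ →
        Σ (ℕ → ℕ) λ KY → Computes K (X ⊕ Ŷ) KY × Sol P X KY)

_×P_ : Problem → Problem → Problem
Inst (P ×P Q) X = Inst P (cmp 0 X) × Inst Q (cmp 1 X)
Sol  (P ×P Q) X Y = Sol P (cmp 0 X) (cmp 0 Y) × Sol Q (cmp 1 X) (cmp 1 Y)

-- ECT.  Instance (n , f): n = X⟨0,0⟩, f x = X⟨1,x⟩ < n.  Solution b = Y 0.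

ECT : Problem
Inst ECT X = ∀ x → cmp 1 X x < cmp 0 X 0
Sol  ECT X Y = ∀ x → Y 0 < x → Σ ℕ λ y → x < y × cmp 1 X x ≡ cmp 1 X y

-- ORT_ℕ.  Poset P = {0,…,p-1} with p = X⟨0,0⟩, u ≤_P v iff X⟨1,⟨u,v⟩⟩ = 1,
-- colour c(x,y) = X⟨2,⟨x,y⟩⟩ (for x < y).  Solution: set H with n ∈ H iff Y n = 1.

module ORTCoding (X : ℕ → ℕ) where
  card : ℕ
  card = cmp 0 X 0
  _≤P_ : ℕ → ℕ → Set
  u ≤P v = cmp 1 X (pair u v) ≡ 1
  col : ℕ → ℕ → ℕ
  col x y = cmp 2 X (pair x y)

  IsInstance : Set
  IsInstance =
    (∀ u → u < card → u ≤P u) ×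
    (∀ u v → u < card → v < card → u ≤P v → v ≤P u → u ≡ v) ×
    (∀ u v w → u < card → v < card → w < card → u ≤P v → v ≤P w → u ≤P w) ×
    (∀ x y → x < y → col x y < card) ×
    (∀ x y y′ → x < y → y ≤ y′ → col x y ≤P col x y′)

ORTℕ : Problem
Inst ORTℕ X = ORTCoding.IsInstance X
Sol  ORTℕ X Y =
  (∀ m → Σ ℕ λ n → m ≤ n × Y n ≡ 1) ×
  (∀ x y x′ y′ → Y x ≡ 1 → Y y ≡ 1 → Y x′ ≡ 1 → Y y′ ≡ 1 →
     x < y → x′ < y′ → ORTCoding.col X x y ≡ ORTCoding.col X x′ y′)

-- Linear order: x ∈ X iff X⟨0,x⟩ = 1, x ≤_X y iff
-- X⟨1,⟨x,y⟩⟩ = 1, with the number 0 its least element.  The sequence σ: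
-- σ_k has length X⟨2,k⟩ and i-th term (b,a) = (X⟨3,⟨k,i⟩⟩, X⟨4,⟨k,i⟩⟩).

-- lexicographic strict order on X^ω, parametrised by the strict order of X:
-- LexLt lt τ σ means τ < σ.
data LexLt (lt : ℕ → ℕ → Set) : List (ℕ × ℕ) → List (ℕ × ℕ) → Set where
  ext    : ∀ {p σ} → LexLt lt [] (p ∷ σ)
  here-b : ∀ {b b′ a a′ τ σ} → b′ < b → LexLt lt ((b′ , a′) ∷ τ) ((b , a) ∷ σ)
  here-a : ∀ {b a a′ τ σ} → lt a′ a → LexLt lt ((b , a′) ∷ τ) ((b , a) ∷ σ)
  there  : ∀ {p τ σ} → LexLt lt τ σ → LexLt lt (p ∷ τ) (p ∷ σ)

module WOPCoding (X : ℕ → ℕ) where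
  Dom : ℕ → Set
  Dom x = cmp 0 X x ≡ 1
  _≤X_ : ℕ → ℕ → Set
  x ≤X y = cmp 1 X (pair x y) ≡ 1
  _<X_ : ℕ → ℕ → Set
  x <X y = x ≤X y × x ≢ y

  len : ℕ → ℕ
  len k = cmp 2 X k
  bb : ℕ → ℕ → ℕ
  bb k i = cmp 3 X (pair k i)
  aa : ℕ → ℕ → ℕ
  aa k i = cmp 4 X (pair k i)

  σ : ℕ → List (ℕ × ℕ)
  σ k = map (λ i → (bb k i , aa k i)) (upTo (len k))

  IsLinearOrder : Set
  IsLinearOrder =
    (∀ x → Dom x → x ≤X x) ×
    (∀ x y → Dom x → Dom y → x ≤X y → y ≤X x → x ≡ y) ×
    (∀ x y z → Dom x → Dom y → Dom z → x ≤X y → y ≤X z → x ≤X z) ×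
    (∀ x y → Dom x → Dom y → x ≤X y ⊎ y ≤X x) ×
    (Dom 0 × (∀ x → Dom x → 0 ≤X x))

  InXω : ℕ → Set
  InXω k =
    (∀ i → suc i < len k → bb k (suc i) < bb k i) ×
    (∀ i → i < len k → Dom (aa k i) × aa k i ≢ 0)

  IsInstance : Set
  IsInstance = IsLinearOrder × (∀ k → InXω k) × (∀ k → LexLt _<X_ (σ (suc k)) (σ k))

  IsSolution : (ℕ → ℕ) → Set
  IsSolution τ =
    (∀ i → Dom (τ i)) × (∀ i → τ (suc i) <X τ i) ×
    (Σ (ℕ → ℕ) λ t → (∀ i j → i < j → t i ≤ t j) ×
       (∀ i → Any (λ p → proj₂ p ≡ τ i) (σ (t i))))

WOP-ω : Problem
Inst WOP-ω X = WOPCoding.IsInstance X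
Sol  WOP-ω X Y = WOPCoding.IsSolution X Y

-- Let f : ℕ → n be the ECT instance and σ the decreasing sequence in X^ω. A pair x < y gets
-- the colour (mask, weight): mask is the n-bit set of f-colours occurring in (x, y], and weight
-- records where σ_y departs from σ_x (the length d of their common prefix, and whether the terms
-- at d differ in the b-entry, in the a-entry, or σ_y ends there), deeper departures weighing less.
-- As σ decreases, both components grow with y, so the colour mask · W + weight (W bounding the
-- weights) is right-ordered for the usual order on an initial segment of ℕ.
-- On an infinite homogeneous set h₀ < h₁ < … consecutive pairs share one colour. Equal masks
-- make every colour used after h₀ recur later, so h₀ solves ECT. Equal weights make all σ_{hₖ}
-- depart from σ_{hₖ₊₁} at one place j in one way. Departing in b would give an infinite descending
-- sequence of naturals, and σ_{h₁} cannot both end at j (after σ_{h₀}) and extend beyond j (before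
-- σ_{h₂}); so they depart in a, and the a-entries at j of σ_{hₖ} descend in X and lie in σ.

module Submission where

open import Defs
open import Data.Fin using () renaming (zero to #0; suc to #s)
open import Data.List using (List; []; _∷_; applyUpTo; length)
open import Data.List.Properties using (map-upTo; length-applyUpTo)
open import Data.List.Relation.Unary.All using (All; []; _∷_)
open import Data.List.Relation.Unary.All.Properties using (applyUpTo⁺₁)
open import Data.List.Relation.Unary.Any using (Any)
open import Data.List.Relation.Unary.Any.Properties using (applyUpTo⁺)
open import Data.Nat
open import Data.Nat.Induction using (<-wellFounded)
open import Data.Nat.Properties
open import Data.Product using (_×_; _,_; proj₁; proj₂; ∃-syntax)
open import Data.Product.Properties using (≡-dec)
open import Data.Sum using (_⊎_; inj₁; inj₂)
open import Data.Unit using (⊤)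
open import Data.Vec using (Vec; []; _∷_)
open import Function using (_∘_)
open import Induction.InfiniteDescent using (InfiniteDescendingSequence; Descent; descent∧wf⇒empty)
open import Relation.Binary.Definitions using (DecidableEquality; tri<; tri≈; tri>)
open import Relation.Binary.PropositionalEquality
open import Relation.Nullary using (¬_; yes; no; contradiction)

x₀ : ∀ {n} → Code (suc n)
x₀ = proj #0
x₁ : ∀ {n} → Code (suc (suc n))
x₁ = proj (#s #0)
x₂ : ∀ {n} → Code (suc (suc (suc n)))
x₂ = proj (#s (#s #0))
x₃ : ∀ {n} → Code (suc (suc (suc (suc n))))
x₃ = proj (#s (#s (#s #0)))

app₁ : ∀ {n} → Code 1 → Code n → Code n
app₁ h a = comp h (a ∷ [])
app₂ : ∀ {n} → Code 2 → Code n → Code n → Code n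
app₂ h a b = comp h (a ∷ b ∷ [])
app₃ : ∀ {n} → Code 3 → Code n → Code n → Code n → Code n
app₃ h a b c = comp h (a ∷ b ∷ c ∷ [])

lit : ℕ → ∀ {n} → Code n
lit zero    = zer
lit (suc k) = app₁ sucC (lit k)

addP : Code 2
addP = prec x₀ (app₁ sucC x₁)

mulP : Code 2
mulP = prec zer (app₂ addP x₂ x₁)

predP : Code 1
predP = prec zer x₀

monusP : Code 2
monusP = prec x₀ (app₁ predP x₁)

isZero : ℕ → ℕ
isZero zero    = 1
isZero (suc _) = 0

isZeroP : Code 1
isZeroP = prec (lit 1) zer

module _ {f : ℕ → ℕ} where

  app₁-eval : ∀ {n h a} {xs : Vec ℕ n} {p r} →
              Eval f a xs p → Eval f h (p ∷ []) r → Eval f (app₁ h a) xs r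
  app₁-eval a h = ecomp (evcons a evnil) h

  app₂-eval : ∀ {n h a b} {xs : Vec ℕ n} {p q r} →
              Eval f a xs p → Eval f b xs q → Eval f h (p ∷ q ∷ []) r → Eval f (app₂ h a b) xs r
  app₂-eval a b h = ecomp (evcons a (evcons b evnil)) h

  app₃-eval : ∀ {n h a b c} {xs : Vec ℕ n} {p q s r} →
              Eval f a xs p → Eval f b xs q → Eval f c xs s →
              Eval f h (p ∷ q ∷ s ∷ []) r → Eval f (app₃ h a b c) xs r
  app₃-eval a b c h = ecomp (evcons a (evcons b (evcons c evnil))) h

  lit-eval : ∀ k {n} {xs : Vec ℕ n} → Eval f (lit k) xs k
  lit-eval zero    = ezer
  lit-eval (suc k) = app₁-eval (lit-eval k) esuc

  addP-eval : ∀ k x → Eval f addP (k ∷ x ∷ []) (k + x)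
  addP-eval zero    x = eprec0 eproj
  addP-eval (suc k) x = eprecS (addP-eval k x) (app₁-eval eproj esuc)

  mulP-eval : ∀ k x → Eval f mulP (k ∷ x ∷ []) (k * x)
  mulP-eval zero    x = eprec0 ezer
  mulP-eval (suc k) x = eprecS (mulP-eval k x) (app₂-eval eproj eproj (addP-eval x (k * x)))

  predP-eval : ∀ k → Eval f predP (k ∷ []) (pred k)
  predP-eval zero    = eprec0 ezer
  predP-eval (suc k) = eprecS (predP-eval k) eproj

  monusP-eval : ∀ y x → Eval f monusP (y ∷ x ∷ []) (x ∸ y)
  monusP-eval zero    x = eprec0 eproj
  monusP-eval (suc y) x =
    eprecS (monusP-eval y x)
           (subst (Eval f _ _) (pred[m∸n]≡m∸[1+n] x y) (app₁-eval eproj (predP-eval (x ∸ y))))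

  isZeroP-eval : ∀ k → Eval f isZeroP (k ∷ []) (isZero k)
  isZeroP-eval zero    = eprec0 (lit-eval 1)
  isZeroP-eval (suc k) = eprecS (isZeroP-eval k) ezer

signum : ℕ → ℕ
signum k = isZero (isZero k)

χ≡ : ℕ → ℕ → ℕ
χ≡ x y = isZero ((x ∸ y) + (y ∸ x))

χ≤ : ℕ → ℕ → ℕ
χ≤ x y = isZero (x ∸ y)

χ< : ℕ → ℕ → ℕ
χ< x y = χ≤ (suc x) y

module _ {n : ℕ} where

  infixl 6 _⊞_ _⊟_
  infixl 7 _⊠_

  _⊞_ _⊠_ _⊟_ : Code n → Code n → Code n
  a ⊞ b = app₂ addP a b
  a ⊠ b = app₂ mulP a b
  a ⊟ b = app₂ monusP b a

  Suc IsZero Signum : Code n → Code n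
  Suc a    = app₁ sucC a
  IsZero a = app₁ isZeroP a
  Signum a = IsZero (IsZero a)

  Eq Le Lt Min : Code n → Code n → Code n
  Eq a b  = IsZero ((a ⊟ b) ⊞ (b ⊟ a))
  Le a b  = IsZero (a ⊟ b)
  Lt a b  = Le (Suc a) b
  Min a b = a ⊟ (a ⊟ b)

m∸[m∸n]≡m⊓n : ∀ m n → m ∸ (m ∸ n) ≡ m ⊓ n
m∸[m∸n]≡m⊓n zero    n       = 0∸n≡0 (0 ∸ n)
m∸[m∸n]≡m⊓n (suc m) zero    = n∸n≡0 (suc m)
m∸[m∸n]≡m⊓n (suc m) (suc n) = trans (+-∸-assoc 1 (m∸n≤m m n)) (cong suc (m∸[m∸n]≡m⊓n m n))

module _ {f : ℕ → ℕ} {n : ℕ} {xs : Vec ℕ n} {a b : Code n} {p q : ℕ}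
         (a-eval : Eval f a xs p) (b-eval : Eval f b xs q) where

  ⊞-eval : Eval f (a ⊞ b) xs (p + q)
  ⊞-eval = app₂-eval a-eval b-eval (addP-eval p q)

  ⊠-eval : Eval f (a ⊠ b) xs (p * q)
  ⊠-eval = app₂-eval a-eval b-eval (mulP-eval p q)

  ⊟-eval : Eval f (a ⊟ b) xs (p ∸ q)
  ⊟-eval = app₂-eval b-eval a-eval (monusP-eval q p)

module _ {f : ℕ → ℕ} {n : ℕ} {xs : Vec ℕ n} where

  Suc-eval : ∀ {a p} → Eval f a xs p → Eval f (Suc a) xs (suc p)
  Suc-eval a-eval = app₁-eval a-eval esuc

  IsZero-eval : ∀ {a p} → Eval f a xs p → Eval f (IsZero a) xs (isZero p)
  IsZero-eval {p = p} a-eval = app₁-eval a-eval (isZeroP-eval p)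

  Signum-eval : ∀ {a p} → Eval f a xs p → Eval f (Signum a) xs (signum p)
  Signum-eval a-eval = IsZero-eval (IsZero-eval a-eval)

  module _ {a b : Code n} {p q : ℕ} (a-eval : Eval f a xs p) (b-eval : Eval f b xs q) where

    Eq-eval : Eval f (Eq a b) xs (χ≡ p q)
    Eq-eval = IsZero-eval (⊞-eval (⊟-eval a-eval b-eval) (⊟-eval b-eval a-eval))

    Le-eval : Eval f (Le a b) xs (χ≤ p q)
    Le-eval = IsZero-eval (⊟-eval a-eval b-eval)

    Lt-eval : Eval f (Lt a b) xs (χ< p q)
    Lt-eval = IsZero-eval (⊟-eval (Suc-eval a-eval) b-eval)

    Min-eval : Eval f (Min a b) xs (p ⊓ q)
    Min-eval = subst (Eval f _ _) (m∸[m∸n]≡m⊓n p q) (⊟-eval a-eval (⊟-eval a-eval b-eval))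

pow2P : Code 1
pow2P = prec (lit 1) (lit 2 ⊠ x₁)

pow2P-eval : ∀ {f} k → Eval f pow2P (k ∷ []) (2 ^ k)
pow2P-eval zero    = eprec0 (lit-eval 1)
pow2P-eval (suc k) = eprecS (pow2P-eval k) (⊠-eval (lit-eval 2) eproj)

isZero≤1 : ∀ k → isZero k ≤ 1
isZero≤1 zero    = ≤-refl
isZero≤1 (suc k) = z≤n

isZero≡1⇒≡0 : ∀ {k} → isZero k ≡ 1 → k ≡ 0
isZero≡1⇒≡0 {zero} _ = refl

isZero≡0⇒>0 : ∀ {k} → isZero k ≡ 0 → 0 < k
isZero≡0⇒>0 {suc k} _ = z<s

signum≤1 : ∀ k → signum k ≤ 1
signum≤1 k = isZero≤1 (isZero k)

signum-mono-≤ : ∀ {k l} → k ≤ l → signum k ≤ signum l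
signum-mono-≤ {zero}          _ = z≤n
signum-mono-≤ {suc k} {suc l} _ = ≤-refl

signum-pos : ∀ {k} → 0 < k → signum k ≡ 1
signum-pos {suc k} _ = refl

signum≡1⇒>0 : ∀ {k} → signum k ≡ 1 → 0 < k
signum≡1⇒>0 {suc k} _ = z<s

χ≡-refl : ∀ x → χ≡ x x ≡ 1
χ≡-refl x rewrite n∸n≡0 x = refl

χ≡≡1⇒≡ : ∀ {x y} → χ≡ x y ≡ 1 → x ≡ y
χ≡≡1⇒≡ {x} {y} eq =
  ≤-antisym (m∸n≡0⇒m≤n (m+n≡0⇒m≡0 (x ∸ y) sum≡0)) (m∸n≡0⇒m≤n (m+n≡0⇒n≡0 (x ∸ y) sum≡0))
  where sum≡0 = isZero≡1⇒≡0 eq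

≢⇒χ≡≡0 : ∀ {x y} → x ≢ y → χ≡ x y ≡ 0
≢⇒χ≡≡0 {x} {y} x≢y with (x ∸ y) + (y ∸ x) in eq
... | suc _ = refl
... | zero  = contradiction (χ≡≡1⇒≡ (cong isZero eq)) x≢y

≤⇒χ≤≡1 : ∀ {x y} → x ≤ y → χ≤ x y ≡ 1
≤⇒χ≤≡1 x≤y rewrite m≤n⇒m∸n≡0 x≤y = refl

χ≤≡1⇒≤ : ∀ {x y} → χ≤ x y ≡ 1 → x ≤ y
χ≤≡1⇒≤ eq = m∸n≡0⇒m≤n (isZero≡1⇒≡0 eq)

χ≤≤1 : ∀ x y → χ≤ x y ≤ 1
χ≤≤1 x y = isZero≤1 (x ∸ y)

χ≡≤1 : ∀ x y → χ≡ x y ≤ 1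
χ≡≤1 x y = isZero≤1 ((x ∸ y) + (y ∸ x))

>⇒χ≤≡0 : ∀ {x y} → y < x → χ≤ x y ≡ 0
>⇒χ≤≡0 {x} {y} y<x with x ∸ y in eq
... | suc _ = refl
... | zero  = contradiction (m∸n≡0⇒m≤n eq) (<⇒≱ y<x)

select : ℕ → ℕ → ℕ → ℕ → ℕ
select 0 a b d = a
select 1 a b d = b
select 2 a b d = d
select _ a b d = 0

χ≡-select : ∀ c a b d → χ≡ c 0 * a + χ≡ c 1 * b + χ≡ c 2 * d ≡ select c a b d
χ≡-select 0                   a b d = trans (+-identityʳ _) (trans (+-identityʳ _) (+-identityʳ a))
χ≡-select 1                   a b d = trans (+-identityʳ _) (+-identityʳ b)
χ≡-select 2                   a b d = +-identityʳ d
χ≡-select (suc (suc (suc _))) a b d = refl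

Select : ∀ {n} → Code n → Code n → Code n → Code n → Code n
Select c a b d = Eq c (lit 0) ⊠ a ⊞ Eq c (lit 1) ⊠ b ⊞ Eq c (lit 2) ⊠ d

Select-eval : ∀ {f n} {xs : Vec ℕ n} {c a b d p q r s} →
              Eval f c xs p → Eval f a xs q → Eval f b xs r → Eval f d xs s →
              Eval f (Select c a b d) xs (select p q r s)
Select-eval {p = p} {q} {r} {s} c-eval a-eval b-eval d-eval =
  subst (Eval _ _ _) (χ≡-select p q r s)
        (⊞-eval (⊞-eval (⊠-eval (Eq-eval c-eval (lit-eval 0)) a-eval)
                        (⊠-eval (Eq-eval c-eval (lit-eval 1)) b-eval))
                (⊠-eval (Eq-eval c-eval (lit-eval 2)) d-eval))

triangleP : Code 1
triangleP = prec zer (Suc x₀ ⊞ x₁)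

pairP : Code 2
pairP = app₁ triangleP (x₀ ⊞ x₁) ⊞ x₁

Pair : ∀ {n} → Code n → Code n → Code n
Pair a b = app₂ pairP a b

diagonal : ℕ → ℕ
diagonal zero    = zero
diagonal (suc k) = diagonal k + χ≤ (triangle (suc (diagonal k))) (suc k)

diagonalP : Code 1
diagonalP = prec zer (x₁ ⊞ Le (app₁ triangleP (Suc x₁)) (Suc x₀))

module _ {f : ℕ → ℕ} where

  triangleP-eval : ∀ k → Eval f triangleP (k ∷ []) (triangle k)
  triangleP-eval zero    = eprec0 ezer
  triangleP-eval (suc k) = eprecS (triangleP-eval k) (⊞-eval (Suc-eval eproj) eproj)

  Pair-eval : ∀ {n} {xs : Vec ℕ n} {a b p q} →
              Eval f a xs p → Eval f b xs q → Eval f (Pair a b) xs (pair p q)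
  Pair-eval {p = p} {q} a-eval b-eval =
    app₂-eval a-eval b-eval (⊞-eval (app₁-eval (⊞-eval eproj eproj) (triangleP-eval (p + q))) eproj)

  diagonalP-eval : ∀ k → Eval f diagonalP (k ∷ []) (diagonal k)
  diagonalP-eval zero    = eprec0 ezer
  diagonalP-eval (suc k) =
    eprecS (diagonalP-eval k)
           (⊞-eval eproj (Le-eval (app₁-eval (Suc-eval eproj) (triangleP-eval (suc (diagonal k))))
                                  (Suc-eval eproj)))

triangle-mono-≤ : ∀ {m n} → m ≤ n → triangle m ≤ triangle n
triangle-mono-≤ {zero}          _         = z≤n
triangle-mono-≤ {suc m} {suc n} (s≤s m≤n) = +-mono-≤ (s≤s m≤n) (triangle-mono-≤ m≤n)

OnDiagonal : ℕ → ℕ → Set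
OnDiagonal s n = triangle s ≤ n × n < triangle (suc s)

diagonal-correct : ∀ n → OnDiagonal (diagonal n) n
diagonal-correct zero = z≤n , s≤s z≤n
diagonal-correct (suc k) with diagonal-correct k | triangle (suc (diagonal k)) ≤? suc k
... | _ , k<next | yes next≤
  rewrite ≤⇒χ≤≡1 next≤ | +-comm (diagonal k) 1
  = next≤ , s≤s (≤-trans k<next (m≤n+m _ (suc (diagonal k))))
... | start≤ , _ | no next≰
  rewrite >⇒χ≤≡0 (≰⇒> next≰) | +-identityʳ (diagonal k) = m≤n⇒m≤1+n start≤ , ≰⇒> next≰

OnDiagonal-unique : ∀ {s s′ n} → OnDiagonal s n → OnDiagonal s′ n → s ≡ s′
OnDiagonal-unique {s} {s′} (start≤ , <next) (start′≤ , <next′) with <-cmp s s′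
... | tri≈ _ s≡s′ _ = s≡s′
... | tri< s<s′ _ _ = contradiction (≤-trans (triangle-mono-≤ s<s′) start′≤) (<⇒≱ <next)
... | tri> _ _ s′<s = contradiction (≤-trans (triangle-mono-≤ s′<s) start≤) (<⇒≱ <next′)

diagonal-pair : ∀ a b → diagonal (pair a b) ≡ a + b
diagonal-pair a b = OnDiagonal-unique (diagonal-correct (pair a b)) (m≤m+n _ b , pair<next)
  where
  pair<next : pair a b < triangle (suc (a + b))
  pair<next = subst (_< suc (a + b) + triangle (a + b)) (+-comm b (triangle (a + b)))
                    (+-monoˡ-< (triangle (a + b)) (s≤s (m≤n+m b a)))

Unpair₁ Unpair₂ : ∀ {n} → Code n → Code n
Unpair₂ a = a ⊟ app₁ triangleP (app₁ diagonalP a)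
Unpair₁ a = app₁ diagonalP a ⊟ Unpair₂ a

unpair₁ unpair₂ : ℕ → ℕ
unpair₂ n = n ∸ triangle (diagonal n)
unpair₁ n = diagonal n ∸ unpair₂ n

Unpair₂-eval : ∀ {f n} {xs : Vec ℕ n} {a p} → Eval f a xs p → Eval f (Unpair₂ a) xs (unpair₂ p)
Unpair₂-eval {p = p} a-eval =
  ⊟-eval a-eval (app₁-eval (app₁-eval a-eval (diagonalP-eval p)) (triangleP-eval (diagonal p)))

Unpair₁-eval : ∀ {f n} {xs : Vec ℕ n} {a p} → Eval f a xs p → Eval f (Unpair₁ a) xs (unpair₁ p)
Unpair₁-eval {p = p} a-eval = ⊟-eval (app₁-eval a-eval (diagonalP-eval p)) (Unpair₂-eval a-eval)

unpair₂-pair : ∀ a b → unpair₂ (pair a b) ≡ b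
unpair₂-pair a b rewrite diagonal-pair a b = m+n∸m≡n (triangle (a + b)) b

unpair₁-pair : ∀ a b → unpair₁ (pair a b) ≡ a
unpair₁-pair a b rewrite unpair₂-pair a b | diagonal-pair a b = m+n∸n≡m a b

unpair-pair : ∀ (g : ℕ → ℕ → ℕ) x y → g (unpair₁ (pair x y)) (unpair₂ (pair x y)) ≡ g x y
unpair-pair g x y = cong₂ g (unpair₁-pair x y) (unpair₂-pair x y)

pair-step : ∀ x i → pair x i < pair x (suc i)
pair-step x i = +-mono-≤-< (triangle-mono-≤ (+-monoʳ-≤ x (n≤1+n i))) (n<1+n i)

*+-<-lex : ∀ W {m m′ w} w′ → w < W → m < m′ → m * W + w < m′ * W + w′
*+-<-lex W {m} {m′} {w} w′ w<W m<m′ = begin-strict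
  m * W + w   <⟨ +-monoʳ-< (m * W) w<W ⟩
  m * W + W   ≡⟨ +-comm (m * W) W ⟩
  suc m * W   ≤⟨ *-monoˡ-≤ W m<m′ ⟩
  m′ * W      ≤⟨ m≤m+n (m′ * W) w′ ⟩
  m′ * W + w′ ∎
  where open ≤-Reasoning

*+-≤-lex : ∀ W {m m′ w w′} → w < W → m ≤ m′ → (m ≡ m′ → w ≤ w′) →
           m * W + w ≤ m′ * W + w′
*+-≤-lex W {m} {w′ = w′} w<W m≤m′ w≤w′ with m≤n⇒m<n∨m≡n m≤m′
... | inj₁ m<m′ = <⇒≤ (*+-<-lex W w′ w<W m<m′)
... | inj₂ refl = +-monoʳ-≤ (m * W) (w≤w′ refl)

*+-injective : ∀ W {m m′ w w′} → w < W → w′ < W →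
               m * W + w ≡ m′ * W + w′ → m ≡ m′ × w ≡ w′
*+-injective W {m} {m′} {w} {w′} w<W w′<W eq with <-cmp m m′
... | tri< m<m′ _ _ = contradiction eq (<⇒≢ (*+-<-lex W w′ w<W m<m′))
... | tri> _ _ m′<m = contradiction (sym eq) (<⇒≢ (*+-<-lex W w w′<W m′<m))
... | tri≈ _ refl _ = refl , +-cancelˡ-≡ (m * W) w w′ eq

binary : (ℕ → ℕ) → ℕ → ℕ
binary d zero    = 0
binary d (suc k) = d k * 2 ^ k + binary d k

module _ {d : ℕ → ℕ} (d≤1 : ∀ v → d v ≤ 1) where

  binary-< : ∀ k → binary d k < 2 ^ k
  binary-< zero    = s≤s z≤n
  binary-< (suc k) = begin-strict
    d k * 2 ^ k + binary d k <⟨ +-monoʳ-< (d k * 2 ^ k) (binary-< k) ⟩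
    d k * 2 ^ k + 2 ^ k      ≤⟨ +-monoˡ-≤ (2 ^ k) (*-monoˡ-≤ (2 ^ k) (d≤1 k)) ⟩
    1 * 2 ^ k + 2 ^ k        ≡⟨ cong (_+ 2 ^ k) (*-identityˡ (2 ^ k)) ⟩
    2 ^ k + 2 ^ k            ≡⟨ cong (2 ^ k +_) (sym (+-identityʳ (2 ^ k))) ⟩
    2 ^ suc k                ∎
    where open ≤-Reasoning

binary-mono : ∀ {d d′} → (∀ v → d v ≤ d′ v) → ∀ k → binary d k ≤ binary d′ k
binary-mono d≤d′ zero    = z≤n
binary-mono d≤d′ (suc k) = +-mono-≤ (*-monoˡ-≤ (2 ^ k) (d≤d′ k)) (binary-mono d≤d′ k)

binary-injective : ∀ {d d′} → (∀ v → d v ≤ 1) → (∀ v → d′ v ≤ 1) →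
                   ∀ k → binary d k ≡ binary d′ k → ∀ v → v < k → d v ≡ d′ v
binary-injective {d} {d′} d≤1 d′≤1 (suc k) eq v v<1+k
  with *+-injective (2 ^ k) {d k} {d′ k} (binary-< d≤1 k) (binary-< d′≤1 k) eq
     | m≤n⇒m<n∨m≡n (≤-pred v<1+k)
... | dk≡ , _    | inj₂ refl = dk≡
... | _ , rest≡ | inj₁ v<k  = binary-injective d≤1 d′≤1 k rest≡ v v<k

no-infinite-descent : (b : ℕ → ℕ) → ¬ InfiniteDescendingSequence _<_ b
no-infinite-descent b descending = descent∧wf⇒empty step <-wellFounded (b 0) (0 , refl)
  where
  step : Descent _<_ (λ x → ∃[ k ] b k ≡ x)
  step (k , refl) = b (suc k) , descending k , suc k , refl

LeastZero : (ℕ → ℕ) → ℕ → Set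
LeastZero p y = p y ≡ 0 × (∀ i → i < y → ∃[ v ] p i ≡ suc v)

zeroBelow : ∀ p n → (∀ i → i < n → ∃[ v ] p i ≡ suc v) ⊎ ∃[ y ] LeastZero p y
zeroBelow p zero    = inj₁ (λ _ ())
zeroBelow p (suc n) with zeroBelow p n
... | inj₂ found = inj₂ found
... | inj₁ positive with p n in pn≡
...   | zero  = inj₂ (n , pn≡ , positive)
...   | suc v = inj₁ positive′
  where
  positive′ : ∀ i → i < suc n → ∃[ v ] p i ≡ suc v
  positive′ i i<1+n with m≤n⇒m<n∨m≡n (≤-pred i<1+n)
  ... | inj₁ i<n  = positive i i<n
  ... | inj₂ refl = v , pn≡

leastZero : ∀ p {n} → p n ≡ 0 → ∃[ y ] LeastZero p y
leastZero p {n} pn≡0 with zeroBelow p n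
... | inj₁ positive = n , pn≡0 , positive
... | inj₂ found    = found

module _ {A : Set} (P : A → Set) (_R_ : A → A → Set)
         (R-trans : ∀ {a b c} → P a → P b → P c → a R b → b R c → a R c) where

  steps⇒chain : (s : ℕ → A) → (∀ k → P (s k)) → (∀ k → s k R s (suc k)) →
                ∀ {k l} → k < l → s k R s l
  steps⇒chain s Ps step {k} {suc l} k<1+l with m≤n⇒m<n∨m≡n (≤-pred k<1+l)
  ... | inj₁ k<l  = R-trans (Ps k) (Ps l) (Ps (suc l)) (steps⇒chain s Ps step k<l) (step l)
  ... | inj₂ refl = step k

steps⇒strictlyIncreasing : (s : ℕ → ℕ) → (∀ k → s k < s (suc k)) → ∀ {k l} → k < l → s k < s l
steps⇒strictlyIncreasing s = steps⇒chain (λ _ → ⊤) _<_ (λ _ _ _ → <-trans) s _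

crossing : (s : ℕ → ℕ) {x : ℕ} → s 0 < x → ∀ m → x ≤ s m → ∃[ i ] s i < x × x ≤ s (suc i)
crossing s s0<x zero    x≤s0 = contradiction x≤s0 (<⇒≱ s0<x)
crossing s {x} s0<x (suc m) x≤sm with s m <? x
... | yes sm<x = m , sm<x , x≤sm
... | no sm≮x  = crossing s s0<x m (≮⇒≥ sm≮x)

decreasing-length : ∀ (b : ℕ → ℕ) n → (∀ i → suc i < n → b (suc i) < b i) → n ≤ suc (b 0)
decreasing-length b zero          _    = z≤n
decreasing-length b (suc zero)    _    = s≤s z≤n
decreasing-length b (suc (suc n)) decr =
  s≤s (≤-trans (decreasing-length (b ∘ suc) (suc n) (λ i → decr (suc i) ∘ s≤s)) (decr 0 (s≤s (s≤s z≤n))))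

bits-product-pos : ∀ {s t} → s ≤ 1 → t ≤ 1 → 0 < s * t → s ≡ 1 × t ≡ 1
bits-product-pos {s} {t} s≤1 t≤1 0<st = m*n≡1⇒m≡1 s t st≡1 , m*n≡1⇒n≡1 s t st≡1
  where st≡1 = ≤-antisym (*-mono-≤ s≤1 t≤1) 0<st

m+n>0⇒m>0⊎n>0 : ∀ m {n} → 0 < m + n → 0 < m ⊎ 0 < n
m+n>0⇒m>0⊎n>0 zero    0<n = inj₂ 0<n
m+n>0⇒m>0⊎n>0 (suc m) _   = inj₁ z<s

≤2⇒≡0 : ∀ {t} → t ≤ 2 → t ≢ 1 → t ≢ 2 → t ≡ 0
≤2⇒≡0 z≤n                 _   _   = refl
≤2⇒≡0 (s≤s z≤n)           t≢1 _   = contradiction refl t≢1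
≤2⇒≡0 (s≤s (s≤s z≤n))     _   t≢2 = contradiction refl t≢2

_≟ᵖ_ : DecidableEquality (ℕ × ℕ)
_≟ᵖ_ = ≡-dec _≟_ _≟_

χ≡ᵖ : ℕ × ℕ → ℕ × ℕ → ℕ
χ≡ᵖ (b , a) (b′ , a′) = χ≡ b b′ * χ≡ a a′

χ≡ᵖ-refl : ∀ p → χ≡ᵖ p p ≡ 1
χ≡ᵖ-refl (b , a) rewrite χ≡-refl b | χ≡-refl a = refl

≢⇒χ≡ᵖ≡0 : ∀ {p q} → p ≢ q → χ≡ᵖ p q ≡ 0
≢⇒χ≡ᵖ≡0 {b , a} {b′ , a′} p≢q with b ≟ b′
... | yes refl rewrite χ≡-refl b | ≢⇒χ≡≡0 (λ a≡a′ → p≢q (cong (b ,_) a≡a′)) = refl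
... | no b≢b′  rewrite ≢⇒χ≡≡0 b≢b′ = refl

divergenceStep : ℕ → ℕ → ℕ × ℕ → ℕ × ℕ
divergenceStep (suc _) _     (d , t) = suc d , t
divergenceStep zero    sameB _       = 0 , isZero sameB

-- Where two lists first differ: the length d of their common prefix, and the kind t of the
-- difference at position d (0: same b, different a; 1: different b; 2: one list ends there).
divergence : List (ℕ × ℕ) → List (ℕ × ℕ) → ℕ × ℕ
divergence (p ∷ L) (q ∷ N) = divergenceStep (χ≡ᵖ p q) (χ≡ (proj₁ p) (proj₁ q)) (divergence L N)
divergence _       _       = 0 , 2

depth kind : List (ℕ × ℕ) → List (ℕ × ℕ) → ℕ
depth L N = proj₁ (divergence L N)
kind  L N = proj₂ (divergence L N)

divergence-same : ∀ p L N → divergence (p ∷ L) (p ∷ N) ≡ (suc (depth L N) , kind L N)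
divergence-same p L N rewrite χ≡ᵖ-refl p = refl

divergence-≡ : ∀ {p q} L N → q ≡ p → divergence (p ∷ L) (q ∷ N) ≡ (suc (depth L N) , kind L N)
divergence-≡ {p} L N refl = divergence-same p L N

divergence-≢ : ∀ p q L N → p ≢ q →
               divergence (p ∷ L) (q ∷ N) ≡ (0 , isZero (χ≡ (proj₁ p) (proj₁ q)))
divergence-≢ p q L N p≢q rewrite ≢⇒χ≡ᵖ≡0 p≢q = refl

divergence-b : ∀ p q L N → proj₁ q < proj₁ p → divergence (p ∷ L) (q ∷ N) ≡ (0 , 1)
divergence-b p q L N b′<b =
  trans (divergence-≢ p q L N (λ p≡q → <⇒≢ b′<b (cong proj₁ (sym p≡q))))
        (cong (λ e → 0 , isZero e) (≢⇒χ≡≡0 (>⇒≢ b′<b)))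

divergence-a : ∀ p q L N → proj₁ q ≡ proj₁ p → proj₂ q ≢ proj₂ p →
               divergence (p ∷ L) (q ∷ N) ≡ (0 , 0)
divergence-a p q L N b′≡b a′≢a =
  trans (divergence-≢ p q L N (λ p≡q → a′≢a (cong proj₂ (sym p≡q))))
        (cong (λ e → 0 , isZero e) (trans (cong (χ≡ (proj₁ p)) b′≡b) (χ≡-refl (proj₁ p))))

depth≤length : ∀ L N → depth L N ≤ length N
depth≤length (p ∷ L) (q ∷ N) with p ≟ᵖ q
... | yes refl rewrite divergence-same p L N = s≤s (depth≤length L N)
... | no p≢q   rewrite divergence-≢ p q L N p≢q = z≤n
depth≤length []      N  = z≤n
depth≤length (_ ∷ _) [] = z≤n

kind≤2 : ∀ L N → kind L N ≤ 2
kind≤2 (p ∷ L) (q ∷ N) with p ≟ᵖ q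
... | yes refl rewrite divergence-same p L N = kind≤2 L N
... | no p≢q   rewrite divergence-≢ p q L N p≢q = m≤n⇒m≤1+n (isZero≤1 _)
kind≤2 []      N  = ≤-refl
kind≤2 (_ ∷ _) [] = ≤-refl

Seq : Set
Seq = ℕ → ℕ × ℕ

infix 4 _≼_
_≼_ : ℕ × ℕ → ℕ × ℕ → Set
(d , t) ≼ (d′ , t′) = d′ < d ⊎ (d′ ≡ d × t ≤ t′)

module Lexicographic (Dom : ℕ → Set) (_<ₓ_ : ℕ → ℕ → Set)
                     (<ₓ-trans : ∀ {a b c} → Dom a → Dom b → Dom c → a <ₓ b → b <ₓ c → a <ₓ c)
                     (<ₓ-irrefl : ∀ {a} → ¬ a <ₓ a) where

  infix 4 _<ˡ_
  _<ˡ_ : List (ℕ × ℕ) → List (ℕ × ℕ) → Set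
  _<ˡ_ = LexLt _<ₓ_

  InDom : List (ℕ × ℕ) → Set
  InDom = All (Dom ∘ proj₂)

  <ˡ-trans : ∀ {N M L} → InDom N → InDom M → InDom L → N <ˡ M → M <ˡ L → N <ˡ L
  <ˡ-trans _ _ _ ext        (here-b _) = ext
  <ˡ-trans _ _ _ ext        (here-a _) = ext
  <ˡ-trans _ _ _ ext        (there _)  = ext
  <ˡ-trans _ _ _ (here-b x) (here-b y) = here-b (<-trans x y)
  <ˡ-trans _ _ _ (here-b x) (here-a _) = here-b x
  <ˡ-trans _ _ _ (here-b x) (there _)  = here-b x
  <ˡ-trans _ _ _ (here-a _) (here-b y) = here-b y
  <ˡ-trans (dn ∷ _) (dm ∷ _) (dl ∷ _) (here-a x) (here-a y) = here-a (<ₓ-trans dn dm dl x y)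
  <ˡ-trans _ _ _ (here-a x) (there _)  = here-a x
  <ˡ-trans _ _ _ (there _)  (here-b y) = here-b y
  <ˡ-trans _ _ _ (there _)  (here-a y) = here-a y
  <ˡ-trans (_ ∷ dn) (_ ∷ dm) (_ ∷ dl) (there x) (there y) = there (<ˡ-trans dn dm dl x y)

  head-b-≤ : ∀ {q p N L} → q ∷ N <ˡ p ∷ L → proj₁ q ≤ proj₁ p
  head-b-≤ (here-b b′<b) = <⇒≤ b′<b
  head-b-≤ (here-a _)    = ≤-refl
  head-b-≤ (there _)     = ≤-refl

  <ₓ⇒≢ : ∀ {a a′} → a′ <ₓ a → a′ ≢ a
  <ₓ⇒≢ a′<a refl = <ₓ-irrefl a′<a

  ≼-[] : ∀ p L M → divergence (p ∷ L) M ≼ (0 , 2)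
  ≼-[] p L M with divergence (p ∷ L) M | kind≤2 (p ∷ L) M
  ... | zero  , _ | t≤2 = inj₂ (refl , t≤2)
  ... | suc _ , _ | _   = inj₁ z<s

  head-≢ : ∀ {q b a a′ N M} → Dom (proj₂ q) → Dom a′ → Dom a →
           q ∷ N <ˡ (b , a′) ∷ M → a′ <ₓ a → q ≢ (b , a)
  head-≢ _  _   _  (here-b b<b)   _    refl = <-irrefl refl b<b
  head-≢ dq da′ da (here-a a<a′) a′<a refl = <ₓ-irrefl (<ₓ-trans dq da′ da a<a′ a′<a)
  head-≢ _  _   _  (there _)      a′<a refl = <ₓ-irrefl a′<a

  ≼-head-≢ : ∀ p q L M N → q ≢ p → divergence (p ∷ L) (p ∷ M) ≼ divergence (p ∷ L) (q ∷ N)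
  ≼-head-≢ p q L M N q≢p rewrite divergence-same p L M | divergence-≢ p q L N (q≢p ∘ sym) = inj₁ z<s

  divergence-antitone : ∀ {N M L} → InDom N → InDom M → InDom L →
                        N <ˡ M → M <ˡ L → divergence L M ≼ divergence L N
  divergence-antitone _ _ _ ext (here-b {b} {b′} {a} {a′} {M} {L} _) = ≼-[] (b , a) L ((b′ , a′) ∷ M)
  divergence-antitone _ _ _ ext (here-a {b} {a} {a′} {M} {L} _)      = ≼-[] (b , a) L ((b , a′) ∷ M)
  divergence-antitone _ _ _ ext (there {p} {M} {L} _)                = ≼-[] p L (p ∷ M)
  divergence-antitone {q ∷ N} _ _ _ x (here-b {b} {b′} {a} {a′} {M} {L} b′<b)
    rewrite divergence-b (b , a) (b′ , a′) L M b′<b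
          | divergence-b (b , a) q L N (≤-<-trans (head-b-≤ x) b′<b) = inj₂ (refl , ≤-refl)
  divergence-antitone {q ∷ N} (dq ∷ _) (da′ ∷ _) (da ∷ _) x (here-a {b} {a} {a′} {M} {L} a′<a)
    rewrite divergence-a (b , a) (b , a′) L M refl (<ₓ⇒≢ a′<a)
          | divergence-≢ (b , a) q L N (head-≢ dq da′ da x a′<a ∘ sym) = inj₂ (refl , z≤n)
  divergence-antitone {q ∷ N} _ _ _ (here-b b″<b) (there {p} {M} {L} _) =
    ≼-head-≢ p q L M N (λ q≡p → <-irrefl (cong proj₁ q≡p) b″<b)
  divergence-antitone {q ∷ N} _ _ _ (here-a a″<a) (there {p} {M} {L} _) =
    ≼-head-≢ p q L M N (λ q≡p → <ₓ⇒≢ a″<a (cong proj₂ q≡p))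
  divergence-antitone {N = _ ∷ N} (_ ∷ dn) (_ ∷ dm) (_ ∷ dl) (there x) (there {p} {M} {L} y)
    rewrite divergence-same p L M | divergence-same p L N with divergence-antitone dn dm dl x y
  ... | inj₁ d<d′        = inj₁ (s≤s d<d′)
  ... | inj₂ (d≡d′ , t≤t′) = inj₂ (cong suc d≡d′ , t≤t′)

  <ˡ-∷-view : ∀ {q p N L} → q ∷ N <ˡ p ∷ L →
              proj₁ q < proj₁ p ⊎ (proj₁ q ≡ proj₁ p × proj₂ q <ₓ proj₂ p) ⊎ (q ≡ p × N <ˡ L)
  <ˡ-∷-view (here-b b′<b) = inj₁ b′<b
  <ˡ-∷-view (here-a a′<a) = inj₂ (inj₁ (refl , a′<a))
  <ˡ-∷-view (there N<L)   = inj₂ (inj₂ (refl , N<L))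

  record FirstDifference (F : Seq) (n : ℕ) (G : Seq) (m : ℕ) (c : ℕ × ℕ) : Set where
    field
      at-a   : proj₂ c ≡ 0 → proj₁ c < n × proj₁ c < m ×
                                proj₂ (G (proj₁ c)) <ₓ proj₂ (F (proj₁ c))
      at-b   : proj₂ c ≡ 1 → proj₁ (G (proj₁ c)) < proj₁ (F (proj₁ c))
      at-end : proj₂ c ≡ 2 → m ≡ proj₁ c × proj₁ c < n

  FirstDifference-∷ : ∀ {F n G m c} → FirstDifference (F ∘ suc) n (G ∘ suc) m c →
                      FirstDifference F (suc n) G (suc m) (suc (proj₁ c) , proj₂ c)
  FirstDifference-∷ r = record
    { at-a   = λ t≡0 → let j<n , j<m , a′<a = at-a t≡0 in s≤s j<n , s≤s j<m , a′<a
    ; at-b   = at-b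
    ; at-end = λ t≡2 → let m≡j , j<n = at-end t≡2 in cong suc m≡j , s≤s j<n
    }
    where open FirstDifference r

  divergence-correct : ∀ F n G m → applyUpTo G m <ˡ applyUpTo F n →
                       FirstDifference F n G m (divergence (applyUpTo F n) (applyUpTo G m))
  divergence-correct F (suc n) G zero    _  = record { at-a = λ () ; at-b = λ () ; at-end = λ _ → refl , z<s }
  divergence-correct F (suc n) G (suc m) lx with <ˡ-∷-view lx
  ... | inj₁ b′<b =
    subst (FirstDifference F (suc n) G (suc m))
          (sym (divergence-b (F 0) (G 0) (applyUpTo (F ∘ suc) n) (applyUpTo (G ∘ suc) m) b′<b))
          (record { at-a = λ () ; at-b = λ _ → b′<b ; at-end = λ () })
  ... | inj₂ (inj₁ (b′≡b , a′<a)) =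
    subst (FirstDifference F (suc n) G (suc m))
          (sym (divergence-a (F 0) (G 0) (applyUpTo (F ∘ suc) n) (applyUpTo (G ∘ suc) m) b′≡b (<ₓ⇒≢ a′<a)))
          (record { at-a = λ _ → z<s , z<s , a′<a ; at-b = λ () ; at-end = λ () })
  ... | inj₂ (inj₂ (G0≡F0 , tails)) =
    subst (FirstDifference F (suc n) G (suc m))
          (sym (divergence-≡ (applyUpTo (F ∘ suc) n) (applyUpTo (G ∘ suc) m) G0≡F0))
          (FirstDifference-∷ (divergence-correct (F ∘ suc) n (G ∘ suc) m tails))

-- Stops growing at the first index where F and G differ.
prefixLength : Seq → Seq → ℕ → ℕ
prefixLength F G zero    = 0
prefixLength F G (suc k) = prefixLength F G k + χ≡ (prefixLength F G k) k * χ≡ᵖ (F k) (G k)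

divergenceKind : Seq → Seq → ℕ → ℕ → ℕ
divergenceKind F G d l = χ≡ d l * 2 + isZero (χ≡ d l) * isZero (χ≡ (proj₁ (F d)) (proj₁ (G d)))

indexDivergence : Seq → ℕ → Seq → ℕ → ℕ × ℕ
indexDivergence F n G m = prefixLength F G (n ⊓ m) , divergenceKind F G (prefixLength F G (n ⊓ m)) (n ⊓ m)

prefixLength-≡ : ∀ F G → χ≡ᵖ (F 0) (G 0) ≡ 1 →
                 ∀ k → prefixLength F G (suc k) ≡ suc (prefixLength (F ∘ suc) (G ∘ suc) k)
prefixLength-≡ F G eq zero    rewrite eq = refl
prefixLength-≡ F G eq (suc k) rewrite prefixLength-≡ F G eq k = refl

prefixLength-≢ : ∀ F G → χ≡ᵖ (F 0) (G 0) ≡ 0 → ∀ k → prefixLength F G k ≡ 0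
prefixLength-≢ F G eq zero          = refl
prefixLength-≢ F G eq (suc zero)    rewrite eq = refl
prefixLength-≢ F G eq (suc (suc k)) rewrite prefixLength-≢ F G eq (suc k) = refl

divergence-applyUpTo : ∀ F n G m → divergence (applyUpTo F n) (applyUpTo G m) ≡ indexDivergence F n G m
divergence-applyUpTo F zero    G m    = refl
divergence-applyUpTo F (suc n) G zero = refl
divergence-applyUpTo F (suc n) G (suc m) with F 0 ≟ᵖ G 0
... | yes F0≡G0 rewrite divergence-≡ (applyUpTo (F ∘ suc) n) (applyUpTo (G ∘ suc) m) (sym F0≡G0)
                      | divergence-applyUpTo (F ∘ suc) n (G ∘ suc) m
                      | prefixLength-≡ F G (subst (λ q → χ≡ᵖ (F 0) q ≡ 1) F0≡G0 (χ≡ᵖ-refl (F 0))) (n ⊓ m) = refl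
... | no F0≢G0 rewrite divergence-≢ (F 0) (G 0) (applyUpTo (F ∘ suc) n) (applyUpTo (G ∘ suc) m) F0≢G0
                     | prefixLength-≢ F G (≢⇒χ≡ᵖ≡0 F0≢G0) (suc (n ⊓ m)) = cong (0 ,_) (sym (+-identityʳ _))

rank : ℕ → ℕ × ℕ → ℕ
rank D (d , t) = (D ∸ d) * 3 + t

module _ (D : ℕ) where

  rank-< : ∀ c → proj₂ c ≤ 2 → rank D c < suc D * 3
  rank-< (d , t) t≤2 = begin-strict
    (D ∸ d) * 3 + t ≤⟨ +-monoʳ-≤ ((D ∸ d) * 3) t≤2 ⟩
    (D ∸ d) * 3 + 2 <⟨ +-monoʳ-< ((D ∸ d) * 3) (n<1+n 2) ⟩
    (D ∸ d) * 3 + 3 ≤⟨ +-monoˡ-≤ 3 (*-monoˡ-≤ 3 (m∸n≤m D d)) ⟩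
    D * 3 + 3       ≡⟨ +-comm (D * 3) 3 ⟩
    suc D * 3       ∎
    where open ≤-Reasoning

  rank-mono : ∀ c c′ → proj₁ c ≤ D → proj₂ c ≤ 2 → c ≼ c′ → rank D c ≤ rank D c′
  rank-mono (d , t) (d′ , t′) d≤D t≤2 (inj₁ d′<d) = <⇒≤ (*+-<-lex 3 t′ (s≤s t≤2) (∸-monoʳ-< d′<d d≤D))
  rank-mono (d , t) (d′ , t′) d≤D t≤2 (inj₂ (refl , t≤t′)) = +-monoʳ-≤ ((D ∸ d) * 3) t≤t′

  rank-injective : ∀ c c′ → proj₁ c ≤ D → proj₁ c′ ≤ D → proj₂ c ≤ 2 → proj₂ c′ ≤ 2 →
                   rank D c ≡ rank D c′ → c ≡ c′
  rank-injective (d , t) (d′ , t′) d≤D d′≤D t≤2 t′≤2 eq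
    with *+-injective 3 {D ∸ d} {D ∸ d′} (s≤s t≤2) (s≤s t′≤2) eq
  ... | D∸d≡D∸d′ , t≡t′ = cong₂ _,_ (∸-cancelˡ-≡ d≤D d′≤D D∸d≡D∸d′) t≡t′

module Colouring (X : ℕ → ℕ) where

  open WOPCoding (cmp 1 X) using (len; bb; aa) public

  colours : ℕ
  colours = cmp 0 (cmp 0 X) 0

  ectColour : ℕ → ℕ
  ectColour = cmp 1 (cmp 0 X)

  entry : ℕ → Seq
  entry k i = bb k i , aa k i

  hits : ℕ → ℕ → ℕ → ℕ
  hits v x zero    = 0
  hits v x (suc k) = hits v x k + χ< x k * χ≡ (ectColour k) v

  occurs : ℕ → ℕ → ℕ → ℕ
  occurs v x y = signum (hits v x (suc y))

  mask : ℕ → ℕ → ℕ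
  mask x y = binary (λ v → occurs v x y) colours

  divergenceOf : ℕ → ℕ → ℕ × ℕ
  divergenceOf x y = indexDivergence (entry x) (len x) (entry y) (len y)

  -- Bounds every len k: b-entries decrease along a term, and leading b-entries never increase.
  maxDepth : ℕ
  maxDepth = suc (bb 0 0)

  weight : ℕ → ℕ → ℕ
  weight x y = rank maxDepth (divergenceOf x y)

  weights : ℕ
  weights = suc maxDepth * 3

  colour : ℕ → ℕ → ℕ
  colour x y = mask x y * weights + weight x y

  size : ℕ
  size = 2 ^ colours * weights

  -- Opaque, so that checking types which mention the instance never unfolds the colouring.
  opaque

    ortInstance : ℕ → ℕ
    ortInstance n = select (unpair₁ n) size (χ≤ (unpair₁ (unpair₂ n)) (unpair₂ (unpair₂ n)))
                                            (colour (unpair₁ (unpair₂ n)) (unpair₂ (unpair₂ n)))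

    ortInstance-pair : ∀ c m → ortInstance (pair c m) ≡ select c size (χ≤ (unpair₁ m) (unpair₂ m))
                                                                     (colour (unpair₁ m) (unpair₂ m))
    ortInstance-pair =
      unpair-pair (λ c m → select c size (χ≤ (unpair₁ m) (unpair₂ m)) (colour (unpair₁ m) (unpair₂ m)))

-- read computes X from the oracle: X itself for the forward functional, the even part of X ⊕ Ŷ
-- for the backward one.
module Programs (read : Code 1) where

  Entry : ∀ {n} → ℕ → ℕ → Code n → Code n
  Entry i j a = app₁ read (Pair (lit i) (Pair (lit j) a))

  Colours : ∀ {n} → Code n
  Colours = Entry 0 0 (lit 0)

  EctColour Len : ∀ {n} → Code n → Code n
  EctColour a = Entry 0 1 a
  Len a       = Entry 1 2 a

  B A : ∀ {n} → Code n → Code n → Code n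
  B k i = Entry 1 3 (Pair k i)
  A k i = Entry 1 4 (Pair k i)

  hitsP : Code 3
  hitsP = prec zer (x₁ ⊞ Lt x₃ x₀ ⊠ Eq (EctColour x₀) x₂)

  occursP : Code 3
  occursP = Signum (app₃ hitsP (Suc x₂) x₀ x₁)

  maskP : Code 3
  maskP = prec zer (app₃ occursP x₀ x₂ x₃ ⊠ app₁ pow2P x₀ ⊞ x₁)

  prefixLengthP : Code 3
  prefixLengthP =
    prec zer (x₁ ⊞ Eq x₁ x₀ ⊠ (Eq (B x₂ x₀) (B x₃ x₀) ⊠ Eq (A x₂ x₀) (A x₃ x₀)))

  MinLen Depth : Code 2
  MinLen = Min (Len x₀) (Len x₁)
  Depth  = app₃ prefixLengthP MinLen x₀ x₁

  Kind : Code 2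
  Kind = Eq Depth MinLen ⊠ lit 2 ⊞ IsZero (Eq Depth MinLen) ⊠ IsZero (Eq (B x₀ Depth) (B x₁ Depth))

  MaxDepth Weights Size : ∀ {n} → Code n
  MaxDepth = Suc (B (lit 0) (lit 0))
  Weights  = Suc MaxDepth ⊠ lit 3
  Size     = app₁ pow2P Colours ⊠ Weights

  colourP : Code 2
  colourP = app₃ maskP Colours x₀ x₁ ⊠ Weights ⊞ ((MaxDepth ⊟ Depth) ⊠ lit 3 ⊞ Kind)

  ortInstanceP : Code 1
  ortInstanceP = Select (Unpair₁ x₀) Size (Le (Unpair₁ (Unpair₂ x₀)) (Unpair₂ (Unpair₂ x₀)))
                                          (app₂ colourP (Unpair₁ (Unpair₂ x₀)) (Unpair₂ (Unpair₂ x₀)))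

module ProgramsCorrect {f : ℕ → ℕ} {read : Code 1} {X : ℕ → ℕ}
                       (read-eval : ∀ m → Eval f read (m ∷ []) (X m)) where

  open Programs read
  open Colouring X

  module _ {n} {xs : Vec ℕ n} where

    Entry-eval : ∀ i j {a p} → Eval f a xs p → Eval f (Entry i j a) xs (cmp j (cmp i X) p)
    Entry-eval i j a-eval = app₁-eval (Pair-eval (lit-eval i) (Pair-eval (lit-eval j) a-eval)) (read-eval _)

    B-eval : ∀ {k i p q} → Eval f k xs p → Eval f i xs q → Eval f (B k i) xs (bb p q)
    B-eval k-eval i-eval = Entry-eval 1 3 (Pair-eval k-eval i-eval)

    A-eval : ∀ {k i p q} → Eval f k xs p → Eval f i xs q → Eval f (A k i) xs (aa p q)
    A-eval k-eval i-eval = Entry-eval 1 4 (Pair-eval k-eval i-eval)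

    MaxDepth-eval : Eval f MaxDepth xs maxDepth
    MaxDepth-eval = Suc-eval (B-eval (lit-eval 0) (lit-eval 0))

    Weights-eval : Eval f Weights xs weights
    Weights-eval = ⊠-eval (Suc-eval MaxDepth-eval) (lit-eval 3)

    Size-eval : Eval f Size xs size
    Size-eval = ⊠-eval (app₁-eval (Entry-eval 0 0 (lit-eval 0)) (pow2P-eval colours)) Weights-eval

  hitsP-eval : ∀ k v x → Eval f hitsP (k ∷ v ∷ x ∷ []) (hits v x k)
  hitsP-eval zero    v x = eprec0 ezer
  hitsP-eval (suc k) v x =
    eprecS (hitsP-eval k v x) (⊞-eval eproj (⊠-eval (Lt-eval eproj eproj) (Eq-eval (Entry-eval 0 1 eproj) eproj)))

  occursP-eval : ∀ v x y → Eval f occursP (v ∷ x ∷ y ∷ []) (occurs v x y)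
  occursP-eval v x y = Signum-eval (app₃-eval (Suc-eval eproj) eproj eproj (hitsP-eval (suc y) v x))

  maskP-eval : ∀ k x y → Eval f maskP (k ∷ x ∷ y ∷ []) (binary (λ v → occurs v x y) k)
  maskP-eval zero    x y = eprec0 ezer
  maskP-eval (suc k) x y =
    eprecS (maskP-eval k x y)
           (⊞-eval (⊠-eval (app₃-eval eproj eproj eproj (occursP-eval k x y))
                           (app₁-eval eproj (pow2P-eval k)))
                   eproj)

  prefixLengthP-eval : ∀ k x y → Eval f prefixLengthP (k ∷ x ∷ y ∷ []) (prefixLength (entry x) (entry y) k)
  prefixLengthP-eval zero    x y = eprec0 ezer
  prefixLengthP-eval (suc k) x y =
    eprecS (prefixLengthP-eval k x y)
           (⊞-eval eproj (⊠-eval (Eq-eval eproj eproj)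
                                 (⊠-eval (Eq-eval (B-eval eproj eproj) (B-eval eproj eproj))
                                         (Eq-eval (A-eval eproj eproj) (A-eval eproj eproj)))))

  module _ (x y : ℕ) where

    MinLen-eval : Eval f MinLen (x ∷ y ∷ []) (len x ⊓ len y)
    MinLen-eval = Min-eval (Entry-eval 1 2 eproj) (Entry-eval 1 2 eproj)

    Depth-eval : Eval f Depth (x ∷ y ∷ []) (proj₁ (divergenceOf x y))
    Depth-eval = app₃-eval MinLen-eval eproj eproj (prefixLengthP-eval _ x y)

    Kind-eval : Eval f Kind (x ∷ y ∷ []) (proj₂ (divergenceOf x y))
    Kind-eval = ⊞-eval (⊠-eval (Eq-eval Depth-eval MinLen-eval) (lit-eval 2))
                       (⊠-eval (IsZero-eval (Eq-eval Depth-eval MinLen-eval))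
                               (IsZero-eval (Eq-eval (B-eval eproj Depth-eval) (B-eval eproj Depth-eval))))

    colourP-eval : Eval f colourP (x ∷ y ∷ []) (colour x y)
    colourP-eval =
      ⊞-eval (⊠-eval (app₃-eval (Entry-eval 0 0 (lit-eval 0)) eproj eproj (maskP-eval colours x y)) Weights-eval)
             (⊞-eval (⊠-eval (⊟-eval MaxDepth-eval Depth-eval) (lit-eval 3)) Kind-eval)

  opaque
    unfolding ortInstance

    ortInstanceP-eval : ∀ n → Eval f ortInstanceP (n ∷ []) (ortInstance n)
    ortInstanceP-eval n =
      Select-eval (Unpair₁-eval eproj) Size-eval
                  (Le-eval (Unpair₁-eval (Unpair₂-eval eproj)) (Unpair₂-eval (Unpair₂-eval eproj)))
                  (app₂-eval (Unpair₁-eval (Unpair₂-eval eproj)) (Unpair₂-eval (Unpair₂-eval eproj)) (colourP-eval _ _))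

module ColouringProperties (X : ℕ → ℕ) where

  open Colouring X

  ortInstance-size : ortInstance (pair 0 0) ≡ size
  ortInstance-size = ortInstance-pair 0 0

  ortInstance-order : ∀ u v → ortInstance (pair 1 (pair u v)) ≡ χ≤ u v
  ortInstance-order u v = trans (ortInstance-pair 1 (pair u v)) (unpair-pair χ≤ u v)

  ortInstance-colour : ∀ x y → ortInstance (pair 2 (pair x y)) ≡ colour x y
  ortInstance-colour x y = trans (ortInstance-pair 2 (pair x y)) (unpair-pair colour x y)

  hits-mono : ∀ v x {k l} → k ≤ l → hits v x k ≤ hits v x l
  hits-mono v x {l = zero}  z≤n = ≤-refl
  hits-mono v x {l = suc l} k≤1+l with m≤n⇒m<n∨m≡n k≤1+l
  ... | inj₁ k<1+l = ≤-trans (hits-mono v x (≤-pred k<1+l)) (m≤m+n (hits v x l) _)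
  ... | inj₂ refl  = ≤-refl

  hits-witness : ∀ v x k → 0 < hits v x k → ∃[ z ] x < z × z < k × ectColour z ≡ v
  hits-witness v x (suc k) pos with m+n>0⇒m>0⊎n>0 (hits v x k) pos
  ... | inj₁ earlier = let z , x<z , z<k , fz≡v = hits-witness v x k earlier in z , x<z , m<n⇒m<1+n z<k , fz≡v
  ... | inj₂ here with bits-product-pos (χ≤≤1 (suc x) k) (χ≡≤1 (ectColour k) v) here
  ...   | x<k , fk≡v = k , χ≤≡1⇒≤ x<k , ≤-refl , χ≡≡1⇒≡ fk≡v

  occurs≤1 : ∀ v x y → occurs v x y ≤ 1
  occurs≤1 v x y = signum≤1 _

  occurs-mono : ∀ v x {y y′} → y ≤ y′ → occurs v x y ≤ occurs v x y′
  occurs-mono v x y≤y′ = signum-mono-≤ (hits-mono v x (s≤s y≤y′))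

  occurs-witness : ∀ v x y → occurs v x y ≡ 1 → ∃[ z ] x < z × z ≤ y × ectColour z ≡ v
  occurs-witness v x y eq = let z , x<z , z<1+y , fz≡v = hits-witness v x (suc y) (signum≡1⇒>0 eq)
                                  in z , x<z , ≤-pred z<1+y , fz≡v

  occurs-intro : ∀ x y z → x < z → z ≤ y → occurs (ectColour z) x y ≡ 1
  occurs-intro x y z x<z z≤y = signum-pos (<-≤-trans hit (hits-mono (ectColour z) x (s≤s z≤y)))
    where
    hit : 0 < hits (ectColour z) x (suc z)
    hit rewrite ≤⇒χ≤≡1 x<z | χ≡-refl (ectColour z) = ≤-trans z<s (m≤n+m 1 _)

  mask<2^colours : ∀ x y → mask x y < 2 ^ colours
  mask<2^colours x y = binary-< (λ v → occurs≤1 v x y) colours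

  mask-mono : ∀ x {y y′} → y ≤ y′ → mask x y ≤ mask x y′
  mask-mono x y≤y′ = binary-mono (λ v → occurs-mono v x y≤y′) colours

  mask-injective : ∀ x y x′ y′ → mask x y ≡ mask x′ y′ →
                   ∀ v → v < colours → occurs v x y ≡ occurs v x′ y′
  mask-injective x y x′ y′ = binary-injective (λ v → occurs≤1 v x y) (λ v → occurs≤1 v x′ y′) colours

module RightOrdered (X : ℕ → ℕ) (wop : WOPCoding.IsInstance (cmp 1 X)) where

  open Colouring X
  open ColouringProperties X
  open WOPCoding (cmp 1 X) using (Dom; _<X_; σ; InXω)

  private
    linear = proj₁ wop
    inXω   = proj₁ (proj₂ wop)

  <X-trans : ∀ {a b c} → Dom a → Dom b → Dom c → a <X b → b <X c → a <X c
  <X-trans {a} {b} {c} da db dc (a≤b , a≢b) (b≤c , _) =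
    proj₁ (proj₂ (proj₂ linear)) a b c da db dc a≤b b≤c ,
    λ { refl → a≢b (proj₁ (proj₂ linear) a b da db a≤b b≤c) }

  <X-irrefl : ∀ {a} → ¬ a <X a
  <X-irrefl (_ , a≢a) = a≢a refl

  open Lexicographic Dom _<X_ <X-trans <X-irrefl public

  term : ℕ → List (ℕ × ℕ)
  term k = applyUpTo (entry k) (len k)

  σ≡term : ∀ k → σ k ≡ term k
  σ≡term k = map-upTo (entry k) (len k)

  term-InDom : ∀ k → InDom (term k)
  term-InDom k = applyUpTo⁺₁ (entry k) (len k) (λ i<len → proj₁ (proj₂ (inXω k) _ i<len))

  term-step : ∀ k → term (suc k) <ˡ term k
  term-step k = subst₂ _<ˡ_ (σ≡term (suc k)) (σ≡term k) (proj₂ (proj₂ wop) k)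

  term-descending : ∀ {x y} → x < y → term y <ˡ term x
  term-descending = steps⇒chain InDom (λ L N → N <ˡ L) (λ dL dM dN L>M M>N → <ˡ-trans dN dM dL M>N L>M)
                                term term-InDom term-step

  -- The case len k = 0 is refuted by term-step k: nothing lies below [].
  len-pos : ∀ k → 0 < len k
  len-pos k with len k | term-step k
  ... | suc _ | _ = z<s

  leadingB-step : ∀ k → bb (suc k) 0 ≤ bb k 0
  leadingB-step k with len k | len (suc k) | term-step k | len-pos (suc k)
  ... | suc _ | suc _ | step | _ = head-b-≤ step

  leadingB≤leadingB₀ : ∀ k → bb k 0 ≤ bb 0 0
  leadingB≤leadingB₀ zero    = ≤-refl
  leadingB≤leadingB₀ (suc k) = ≤-trans (leadingB-step k) (leadingB≤leadingB₀ k)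

  len≤maxDepth : ∀ k → len k ≤ maxDepth
  len≤maxDepth k =
    ≤-trans (decreasing-length (bb k) (len k) (proj₁ (inXω k))) (s≤s (leadingB≤leadingB₀ k))

  divergence-term : ∀ x y → divergence (term x) (term y) ≡ divergenceOf x y
  divergence-term x y = divergence-applyUpTo (entry x) (len x) (entry y) (len y)

  depthOf≤maxDepth : ∀ x y → proj₁ (divergenceOf x y) ≤ maxDepth
  depthOf≤maxDepth x y = begin
    proj₁ (divergenceOf x y)       ≡⟨ cong proj₁ (divergence-term x y) ⟨
    depth (term x) (term y)        ≤⟨ depth≤length (term x) (term y) ⟩
    length (term y)                ≡⟨ length-applyUpTo (entry y) (len y) ⟩
    len y                          ≤⟨ len≤maxDepth y ⟩
    maxDepth                       ∎
    where open ≤-Reasoning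

  kindOf≤2 : ∀ x y → proj₂ (divergenceOf x y) ≤ 2
  kindOf≤2 x y = subst (_≤ 2) (cong proj₂ (divergence-term x y)) (kind≤2 (term x) (term y))

  weight<weights : ∀ x y → weight x y < weights
  weight<weights x y = rank-< maxDepth (divergenceOf x y) (kindOf≤2 x y)

  colour<size : ∀ x y → colour x y < size
  colour<size x y = begin-strict
    mask x y * weights + weight x y <⟨ +-monoʳ-< (mask x y * weights) (weight<weights x y) ⟩
    mask x y * weights + weights    ≡⟨ +-comm (mask x y * weights) weights ⟩
    suc (mask x y) * weights        ≤⟨ *-monoˡ-≤ weights (mask<2^colours x y) ⟩
    size                            ∎
    where open ≤-Reasoning

  weight-mono : ∀ x y y′ → x < y → y < y′ → weight x y ≤ weight x y′
  weight-mono x y y′ x<y y<y′ =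
    rank-mono maxDepth (divergenceOf x y) (divergenceOf x y′) (depthOf≤maxDepth x y) (kindOf≤2 x y)
      (subst₂ _≼_ (divergence-term x y) (divergence-term x y′)
              (divergence-antitone (term-InDom y′) (term-InDom y) (term-InDom x)
                                   (term-descending y<y′) (term-descending x<y)))

  colour-mono : ∀ x y y′ → x < y → y ≤ y′ → colour x y ≤ colour x y′
  colour-mono x y y′ x<y y≤y′ =
    *+-≤-lex weights (weight<weights x y) (mask-mono x y≤y′) (λ _ → weight≤ (m≤n⇒m<n∨m≡n y≤y′))
    where
    weight≤ : ∀ {z} → y < z ⊎ y ≡ z → weight x y ≤ weight x z
    weight≤ (inj₁ y<z) = weight-mono x y _ x<y y<z
    weight≤ (inj₂ refl) = ≤-refl

  firstDifference : ∀ {x y} → x < y →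
                    FirstDifference (entry x) (len x) (entry y) (len y) (divergenceOf x y)
  firstDifference {x} {y} x<y =
    subst (FirstDifference (entry x) (len x) (entry y) (len y)) (divergence-term x y)
          (divergence-correct (entry x) (len x) (entry y) (len y) (term-descending x<y))

  ortInstance-valid : ORTCoding.IsInstance ortInstance
  ortInstance-valid =
    (λ u _ → ≤⇒≤P u u ≤-refl) ,
    (λ u v _ _ u≤v v≤u → ≤-antisym (≤P⇒≤ u v u≤v) (≤P⇒≤ v u v≤u)) ,
    (λ u v w _ _ _ u≤v v≤w → ≤⇒≤P u w (≤-trans (≤P⇒≤ u v u≤v) (≤P⇒≤ v w v≤w))) ,
    (λ x y _ → subst₂ _<_ (sym (ortInstance-colour x y)) (sym ortInstance-size) (colour<size x y)) ,
    (λ x y y′ x<y y≤y′ → ≤⇒≤P (col x y) (col x y′)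
                                (subst₂ _≤_ (sym (ortInstance-colour x y)) (sym (ortInstance-colour x y′))
                                            (colour-mono x y y′ x<y y≤y′)))
    where
    open ORTCoding ortInstance using (_≤P_; col)
    ≤⇒≤P : ∀ u v → u ≤ v → u ≤P v
    ≤⇒≤P u v u≤v = trans (ortInstance-order u v) (≤⇒χ≤≡1 u≤v)
    ≤P⇒≤ : ∀ u v → u ≤P v → u ≤ v
    ≤P⇒≤ u v u≤v = χ≤≡1⇒≤ (trans (sym (ortInstance-order u v)) u≤v)

⊕-even : ∀ (X Y : ℕ → ℕ) m → (X ⊕ Y) (m + m) ≡ X m
⊕-even X Y zero    = refl
⊕-even X Y (suc m) rewrite +-suc m m = ⊕-even (X ∘ suc) (Y ∘ suc) m

⊕-odd : ∀ (X Y : ℕ → ℕ) m → (X ⊕ Y) (suc (m + m)) ≡ Y m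
⊕-odd X Y zero    = refl
⊕-odd X Y (suc m) rewrite +-suc m m = ⊕-odd (X ∘ suc) (Y ∘ suc) m

readLeft readRight : Code 1
readLeft  = app₁ orc (x₀ ⊞ x₀)
readRight = app₁ orc (Suc (x₀ ⊞ x₀))

readLeft-eval : ∀ X Y m → Eval (X ⊕ Y) readLeft (m ∷ []) (X m)
readLeft-eval X Y m = subst (Eval _ _ _) (⊕-even X Y m) (app₁-eval (⊞-eval eproj eproj) eorc)

readRight-eval : ∀ X Y m → Eval (X ⊕ Y) readRight (m ∷ []) (Y m)
readRight-eval X Y m = subst (Eval _ _ _) (⊕-odd X Y m) (app₁-eval (Suc-eval (⊞-eval eproj eproj)) eorc)

module Enumeration (Ŷ : ℕ → ℕ) (infinite : ∀ m → ∃[ n ] m ≤ n × Ŷ n ≡ 1) where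

  nonMemberFrom : ℕ → ℕ → ℕ
  nonMemberFrom s y = isZero (χ≡ (Ŷ y) 1 * χ≤ s y)

  nonMemberFrom-witness : ∀ s → nonMemberFrom s (proj₁ (infinite s)) ≡ 0
  nonMemberFrom-witness s with infinite s
  ... | n , s≤n , Ŷn≡1 rewrite Ŷn≡1 | ≤⇒χ≤≡1 s≤n = refl

  next : ℕ → ℕ
  next s = proj₁ (leastZero (nonMemberFrom s) (nonMemberFrom-witness s))

  next-least : ∀ s → LeastZero (nonMemberFrom s) (next s)
  next-least s = proj₂ (leastZero (nonMemberFrom s) (nonMemberFrom-witness s))

  next-member : ∀ s → Ŷ (next s) ≡ 1 × s ≤ next s
  next-member s
    with bits-product-pos (χ≡≤1 (Ŷ (next s)) 1) (χ≤≤1 s (next s)) (isZero≡0⇒>0 (proj₁ (next-least s)))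
  ... | Ŷ≡1 , s≤ = χ≡≡1⇒≡ Ŷ≡1 , χ≤≡1⇒≤ s≤

  enum : ℕ → ℕ
  enum zero    = next 0
  enum (suc k) = next (suc (enum k))

  enum-member : ∀ k → Ŷ (enum k) ≡ 1
  enum-member zero    = proj₁ (next-member 0)
  enum-member (suc k) = proj₁ (next-member (suc (enum k)))

  enum-step : ∀ k → enum k < enum (suc k)
  enum-step k = proj₂ (next-member (suc (enum k)))

  enum-increasing : ∀ {k l} → k < l → enum k < enum l
  enum-increasing = steps⇒strictlyIncreasing enum enum-step

  n≤enum : ∀ n → n ≤ enum n
  n≤enum zero    = z≤n
  n≤enum (suc n) = ≤-trans (s≤s (n≤enum n)) (enum-step n)

nonMemberFromP : Code 2
nonMemberFromP = IsZero (Eq (app₁ readRight x₀) (lit 1) ⊠ Le x₁ x₀)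

nextP : Code 1
nextP = mu nonMemberFromP

enumP : Code 1
enumP = prec (app₁ nextP (lit 0)) (app₁ nextP (Suc x₁))

module EnumerationCorrect (X Ŷ : ℕ → ℕ) (infinite : ∀ m → ∃[ n ] m ≤ n × Ŷ n ≡ 1) where

  open Enumeration Ŷ infinite

  nonMemberFromP-eval : ∀ y s → Eval (X ⊕ Ŷ) nonMemberFromP (y ∷ s ∷ []) (nonMemberFrom s y)
  nonMemberFromP-eval y s =
    IsZero-eval (⊠-eval (Eq-eval (app₁-eval eproj (readRight-eval X Ŷ y)) (lit-eval 1)) (Le-eval eproj eproj))

  nextP-eval : ∀ s → Eval (X ⊕ Ŷ) nextP (s ∷ []) (next s)
  nextP-eval s with next-least s
  ... | zero-at , positive-below =
    emu (subst (Eval _ _ _) zero-at (nonMemberFromP-eval (next s) s))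
        (λ i i<y → let v , eq = positive-below i i<y in v , subst (Eval _ _ _) eq (nonMemberFromP-eval i s))

  enumP-eval : ∀ k → Eval (X ⊕ Ŷ) enumP (k ∷ []) (enum k)
  enumP-eval zero    = eprec0 (app₁-eval (lit-eval 0) (nextP-eval 0))
  enumP-eval (suc k) = eprecS (enumP-eval k) (app₁-eval (Suc-eval eproj) (nextP-eval (suc (enum k))))

solutionP : Code 1
solutionP = IsZero x₀ ⊠ app₁ enumP (lit 0)
          ⊞ Signum x₀ ⊠ A (app₁ enumP x₀) (app₂ Depth (app₁ enumP (lit 0)) (app₁ enumP (lit 1)))
  where open Programs readLeft

module Decoding (X Ŷ : ℕ → ℕ) (infinite : ∀ m → ∃[ n ] m ≤ n × Ŷ n ≡ 1) where

  open Enumeration Ŷ infinite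
  open Colouring X

  depth₀ : ℕ
  depth₀ = proj₁ (divergenceOf (enum 0) (enum 1))

  -- Position 0 = ⟨0,0⟩ holds the ECT bound; the WOP sequence sits at the positions ⟨1,i⟩ > 0.
  solution : ℕ → ℕ
  solution zero    = enum 0
  solution (suc n) = aa (enum (suc n)) depth₀

  solution-by-cases : ∀ n → isZero n * enum 0 + signum n * aa (enum n) depth₀ ≡ solution n
  solution-by-cases zero    = trans (+-identityʳ _) (+-identityʳ (enum 0))
  solution-by-cases (suc n) = +-identityʳ (aa (enum (suc n)) depth₀)

  solutionP-eval : ∀ n → Eval (X ⊕ Ŷ) solutionP (n ∷ []) (solution n)
  solutionP-eval n =
    subst (Eval _ _ _) (solution-by-cases n)
      (⊞-eval (⊠-eval (IsZero-eval eproj) (app₁-eval (lit-eval 0) (enumP-eval 0)))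
              (⊠-eval (Signum-eval eproj)
                      (A-eval (app₁-eval eproj (enumP-eval n))
                              (app₂-eval (app₁-eval (lit-eval 0) (enumP-eval 0)) (app₁-eval (lit-eval 1) (enumP-eval 1))
                                         (Depth-eval _ _)))))
    where
    open EnumerationCorrect X Ŷ infinite
    open ProgramsCorrect (readLeft-eval X Ŷ)

module Homogeneous (X Ŷ : ℕ → ℕ) (ect : Inst ECT (cmp 0 X)) (wop : Inst WOP-ω (cmp 1 X))
                   (hom : Sol ORTℕ (Colouring.ortInstance X) Ŷ) where

  open Colouring X
  open ColouringProperties X
  open RightOrdered X wop
  open Enumeration Ŷ (proj₁ hom)
  open Decoding X Ŷ (proj₁ hom)
  open WOPCoding (cmp 1 X) using (Dom; _<X_; σ)

  colour-constant : ∀ k → colour (enum k) (enum (suc k)) ≡ colour (enum 0) (enum 1)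
  colour-constant k = begin
    colour (enum k) (enum (suc k))
      ≡⟨ ortInstance-colour (enum k) (enum (suc k)) ⟨
    ortInstance (pair 2 (pair (enum k) (enum (suc k))))
      ≡⟨ proj₂ hom _ _ _ _ (enum-member k) (enum-member (suc k)) (enum-member 0) (enum-member 1)
                           (enum-step k) (enum-step 0) ⟩
    ortInstance (pair 2 (pair (enum 0) (enum 1)))
      ≡⟨ ortInstance-colour (enum 0) (enum 1) ⟩
    colour (enum 0) (enum 1) ∎
    where open ≡-Reasoning

  mask-and-weight-constant : ∀ k → mask (enum k) (enum (suc k)) ≡ mask (enum 0) (enum 1)
                                 × weight (enum k) (enum (suc k)) ≡ weight (enum 0) (enum 1)
  mask-and-weight-constant k =
    *+-injective weights (weight<weights (enum k) (enum (suc k))) (weight<weights (enum 0) (enum 1))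
                 (colour-constant k)

  divergence-constant : ∀ k → divergenceOf (enum k) (enum (suc k)) ≡ divergenceOf (enum 0) (enum 1)
  divergence-constant k =
    rank-injective maxDepth (divergenceOf (enum k) (enum (suc k))) (divergenceOf (enum 0) (enum 1))
                   (depthOf≤maxDepth (enum k) (enum (suc k))) (depthOf≤maxDepth (enum 0) (enum 1))
                   (kindOf≤2 (enum k) (enum (suc k))) (kindOf≤2 (enum 0) (enum 1))
                   (proj₂ (mask-and-weight-constant k))

  ectSolution : Sol ECT (cmp 0 X) (cmp 0 solution)
  ectSolution x enum₀<x =
    let i , enumᵢ<x , x≤enumᵢ₊₁ = crossing enum enum₀<x x (n≤enum x)
        same-masks = trans (proj₁ (mask-and-weight-constant i)) (sym (proj₁ (mask-and-weight-constant (suc i))))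
        occurs-next = trans (sym (mask-injective (enum i) (enum (suc i)) (enum (suc i)) (enum (suc (suc i)))
                                                 same-masks (ectColour x) (ect x)))
                            (occurs-intro (enum i) (enum (suc i)) x enumᵢ<x x≤enumᵢ₊₁)
        z , enumᵢ₊₁<z , _ , fz≡fx = occurs-witness (ectColour x) (enum (suc i)) (enum (suc (suc i))) occurs-next
    in z , ≤-<-trans x≤enumᵢ₊₁ enumᵢ₊₁<z , sym fz≡fx

  difference : ∀ k → FirstDifference (entry (enum k)) (len (enum k)) (entry (enum (suc k))) (len (enum (suc k)))
                                     (divergenceOf (enum 0) (enum 1))
  difference k = subst (FirstDifference (entry (enum k)) (len (enum k)) (entry (enum (suc k))) (len (enum (suc k))))
                       (divergence-constant k) (firstDifference (enum-step k))

  open FirstDifference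

  kind₀≡0 : proj₂ (divergenceOf (enum 0) (enum 1)) ≡ 0
  kind₀≡0 = ≤2⇒≡0 (kindOf≤2 (enum 0) (enum 1)) kind≢1 kind≢2
    where
    kind≢1 : proj₂ (divergenceOf (enum 0) (enum 1)) ≢ 1
    kind≢1 t≡1 = no-infinite-descent (λ k → bb (enum k) depth₀) (λ k → at-b (difference k) t≡1)
    kind≢2 : proj₂ (divergenceOf (enum 0) (enum 1)) ≢ 2
    kind≢2 t≡2 = <-irrefl (sym (proj₁ (at-end (difference 0) t≡2))) (proj₂ (at-end (difference 1) t≡2))

  depth₀<len : ∀ k → depth₀ < len (enum k)
  depth₀<len k = proj₁ (at-a (difference k) kind₀≡0)

  a-step : ∀ k → aa (enum (suc k)) depth₀ <X aa (enum k) depth₀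
  a-step k = proj₂ (proj₂ (at-a (difference k) kind₀≡0))

  a-Dom : ∀ k → Dom (aa (enum k) depth₀)
  a-Dom k = proj₁ (proj₂ (proj₁ (proj₂ wop) (enum k)) depth₀ (depth₀<len k))

  a-decreasing : ∀ {k l} → k < l → aa (enum l) depth₀ <X aa (enum k) depth₀
  a-decreasing = steps⇒chain Dom (λ a b → b <X a) (λ da db dc b<a c<b → <X-trans dc db da c<b b<a)
                             (λ k → aa (enum k) depth₀) a-Dom a-step

  wopSolution : Sol WOP-ω (cmp 1 X) (cmp 1 solution)
  wopSolution =
    (λ i → a-Dom (pair 1 i)) ,
    (λ i → a-decreasing (pair-step 1 i)) ,
    (λ i → enum (pair 1 i)) ,
    (λ i j i<j → <⇒≤ (enum-increasing (steps⇒strictlyIncreasing (pair 1) (pair-step 1) i<j))) ,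
    (λ i → subst (Any _) (sym (σ≡term (enum (pair 1 i))))
                 (applyUpTo⁺ (entry (enum (pair 1 i))) refl (depth₀<len (pair 1 i))))

mainTheorem4 : (ECT ×P WOP-ω) ≤W ORTℕ
mainTheorem4 = Programs.ortInstanceP orc , solutionP , λ X (ect , wop) →
  Colouring.ortInstance X , ProgramsCorrect.ortInstanceP-eval (λ _ → eorc) , RightOrdered.ortInstance-valid X wop ,
  λ Ŷ hom → Decoding.solution X Ŷ (proj₁ hom) , Decoding.solutionP-eval X Ŷ (proj₁ hom) ,
            Homogeneous.ectSolution X Ŷ ect wop hom , Homogeneous.wopSolution X Ŷ ect wop hom
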